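{- Let $G$ and $H$ be finite groups, $X$ a finite $G$-set, and let $S_h\subseteq X$ ($h\in H$) be pairwise disjoint subsets with $\bigcup_{h\in H}S_h=X$ (some $S_h$ may be empty). Then the following are equivalent: (i) $\{S_h: h\in H\}$ is a $(G,H)$-related difference family of $X$; (ii) $\sum_{h\in H}|\alpha S_h\cap S_{\sigma h}|=|X|/|H|$ for all $\alpha\in G\setminus\{1_G\}$ and all $\sigma\in H\setminus\{1_H\}$; (iii) $\sum_{h\in H}|\alpha S_h\cap S_{\sigma h}|=|X|/|H|$ for all $\alpha\in G\setminus\{1_G\}$ and all $\sigma\in H$.
   Context: $X$ is a $G$-set (a set with an action $(\alpha,x)\mapsto\alpha x$ of $G$), and $\alpha C=\{\alpha x:x\in C\}$. Given pairwise disjoint subsets $S_h\subseteq X$ ($h\in H$) with union $X$, the family $\{S_h:h\in H\}$ is called a $(G,H)$-related difference family of $X$ if for every $\alpha\in G\setminus\{1_G\}$ and every $\sigma\in H\setminus\{1_H\}$ there are exactly $|X|/|H|$ pairs $(x,y)\in\bigcup_{h\in H}(S_h\times S_{\sigma h})$ with $\alpha x=y$. -}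

module Defs where

open import Data.Nat using (ℕ; _*_)
open import Data.Fin using (Fin; _≟_)
open import Data.Fin.Properties using (any?)
open import Data.Fin.Subset using (Subset; _∈_; _∩_; ∣_∣)
open import Data.Fin.Subset.Properties using (_∈?_)
open import Data.Vec using (tabulate)
open import Data.List using (List; length; filter; cartesianProduct; allFin; map)
open import Data.Nat.ListAction using (sum)
open import Data.Product using (Σ; ∃; _×_; _,_; proj₁; proj₂)
open import Relation.Nullary using (does; ¬_; _×-dec_)
open import Relation.Binary.PropositionalEquality using (_≡_)
open import Algebra.Structures using (IsGroup)

-- A finite group of order n, presented on the carrier Fin n
-- (every finite group is isomorphic to one of this form).
record FinGroup (n : ℕ) : Set where
  infixl 7 _∙_
  field
    _∙_     : Fin n → Fin n → Fin n
    ε       : Fin n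
    _⁻¹     : Fin n → Fin n
    isGroup : IsGroup _≡_ _∙_ ε _⁻¹

record Action {g : ℕ} (G : FinGroup g) (m : ℕ) : Set where
  open FinGroup G
  field
    act      : Fin g → Fin m → Fin m
    act-id   : ∀ x → act ε x ≡ x
    act-comp : ∀ a b x → act (a ∙ b) x ≡ act a (act b x)

module _ {g k m : ℕ} (G : FinGroup g) (H : FinGroup k) (A : Action G m)
         (S : Fin k → Subset m) where
  open Action A
  private module H = FinGroup H
  private module G = FinGroup G

  image : Fin g → Subset m → Subset m
  image α C = tabulate λ y → does (any? λ x → (x ∈? C) ×-dec (act α x ≟ y))

  pairCount : Fin g → Fin k → ℕ
  pairCount α σ =
    length (filter (λ p → let x = proj₁ p ; y = proj₂ p in
                      any? (λ h → (x ∈? S h) ×-dec (y ∈? S (σ H.∙ h))) ×-dec (act α x ≟ y))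
                   (cartesianProduct (allFin m) (allFin m)))

  intersectionSum : Fin g → Fin k → ℕ
  intersectionSum α σ = sum (map (λ h → ∣ image α (S h) ∩ S (σ H.∙ h) ∣) (allFin k))

  -- "= |X|/|H|" is expressed as "· |H| = |X|" (|H| = k ≥ 1).
  -- (G,H)-related difference family
  IsRelatedDifferenceFamily : Set
  IsRelatedDifferenceFamily =
    ∀ α → ¬ α ≡ G.ε → ∀ σ → ¬ σ ≡ H.ε → pairCount α σ * k ≡ m

  ConditionII : Set
  ConditionII = ∀ α → ¬ α ≡ G.ε → ∀ σ → ¬ σ ≡ H.ε → intersectionSum α σ * k ≡ m

  ConditionIII : Set
  ConditionIII = ∀ α → ¬ α ≡ G.ε → ∀ σ → intersectionSum α σ * k ≡ m

-- The pair count of (i) and the sum in (ii) both equal the number of incidences (h, x)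
-- with x ∈ S_h and αx ∈ S_{σh}: the pair count because, the S_h being disjoint, each x
-- lies in at most one S_h; the sum because x ↦ αx is a bijection of X. Summing the
-- incidences over all σ ∈ H counts every x ∈ X exactly once (σ ↦ σh is a bijection of H
-- and the S_h partition X), so the |H| sums for a fixed α add up to |X|. Hence if all of
-- them with σ ≠ 1 equal |X|/|H|, so does the one with σ = 1.
module Submission where

open import Defs
open import Data.Nat using (ℕ)
open import Data.Fin using (Fin)
open import Data.Fin.Subset using (Subset; _∈_)
open import Data.Product using (∃; _×_)
open import Relation.Binary.PropositionalEquality using (_≡_)
open import Function.Bundles using (_⇔_)

open import Algebra.Bundles using (Group)
open import Algebra.Structures using (IsGroup)
open import Data.Bool using (Bool; true; false; _∧_)
open import Data.Bool.Properties using (∧-zeroʳ; ∧-identityʳ)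
open import Data.Fin using (zero; suc; punchIn; _≟_)
open import Data.Fin.Permutation using (permutation)
open import Data.Fin.Properties using (any?; punchInᵢ≢i)
open import Data.Fin.Subset using (inside; outside; _∩_; ∣_∣)
open import Data.Fin.Subset.Properties using (_∈?_)
open import Data.List using (List; _++_; filter; length; tabulate; map; allFin; cartesianProduct)
open import Data.List.Properties using (filter-++; length-++; map-tabulate)
open import Data.Nat using (zero; suc; _+_; _*_)
import Data.Nat.ListAction as ListAction
open import Data.Nat.Properties
  using (+-*-semiring; +-identityʳ; +-cancelʳ-≡; *-comm; *-identityʳ; *-zeroʳ)
open import Data.Product using (_,_)
open import Data.Vec using (_∷_; []; lookup)
open import Data.Vec.Properties using (lookup-zipWith; lookup∘tabulate)
open import Function using (_∘_; id)
open import Function.Bundles using (mk⇔)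
open import Relation.Binary.PropositionalEquality
  using (_≢_; refl; sym; trans; cong; cong₂; subst; module ≡-Reasoning)
open import Relation.Nullary using (Dec; does; yes; no; _×-dec_)
open import Relation.Nullary.Decidable using (dec-true; dec-false; does-⇔)
open import Relation.Unary using (Pred; Decidable)

open import Algebra.Properties.Semiring.Sum +-*-semiring
  using (sum; sum-cong-≗; sum-remove; sum-permute; ∑-comm; *-distribˡ-sum; *-distribʳ-sum)

open ≡-Reasoning

indicator : Bool → ℕ
indicator true  = 1
indicator false = 0

indicator-∧ : ∀ a b → indicator (a ∧ b) ≡ indicator a * indicator b
indicator-∧ true  b = sym (+-identityʳ (indicator b))
indicator-∧ false b = refl

sum-const : ∀ n c → sum {n} (λ _ → c) ≡ n * c
sum-const zero    c = refl
sum-const (suc n) c = cong (c +_) (sum-const n c)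

sum-off-point : ∀ {n} (f : Fin (suc n) → ℕ) i c → (∀ j → j ≢ i → f j ≡ c) →
                sum f ≡ f i + n * c
sum-off-point {n} f i c off = begin
  sum f                              ≡⟨ sum-remove f ⟩
  f i + sum (f ∘ punchIn i)          ≡⟨ cong (f i +_) (sum-cong-≗ (λ j → off _ (punchInᵢ≢i i j))) ⟩
  f i + sum {n} (λ _ → c)            ≡⟨ cong (f i +_) (sum-const n c) ⟩
  f i + n * c                        ∎

sum-supported-at : ∀ {n} (f : Fin n → ℕ) i → (∀ j → j ≢ i → f j ≡ 0) → sum f ≡ f i
sum-supported-at {zero}  f ()
sum-supported-at {suc n} f i off = begin
  sum f        ≡⟨ sum-off-point f i 0 off ⟩
  f i + n * 0  ≡⟨ cong (f i +_) (*-zeroʳ n) ⟩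
  f i + 0      ≡⟨ +-identityʳ (f i) ⟩
  f i          ∎

value-from-sum : ∀ {n} (f : Fin n → ℕ) i c → (∀ j → j ≢ i → f j ≡ c) →
                 sum f ≡ n * c → f i ≡ c
value-from-sum {zero}  f ()
value-from-sum {suc n} f i c off sum≡ = +-cancelʳ-≡ (n * c) (f i) c (begin
  f i + n * c  ≡⟨ sum-off-point f i c off ⟨
  sum f        ≡⟨ sum≡ ⟩
  c + n * c    ∎)

sum-∘-inverse : ∀ {n} (f : Fin n → ℕ) (p q : Fin n → Fin n) →
                (∀ y → p (q y) ≡ y) → (∀ x → q (p x) ≡ x) → sum (f ∘ p) ≡ sum f
sum-∘-inverse f p q p∘q q∘p = sym (sum-permute f (permutation p q p∘q q∘p))

sum-∧-≟ : ∀ {n} (b : Fin n → Bool) i → sum (λ j → indicator (b j ∧ does (i ≟ j))) ≡ indicator (b i)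
sum-∧-≟ b i = begin
  sum (λ j → indicator (b j ∧ does (i ≟ j)))  ≡⟨ sum-supported-at _ i off-diagonal ⟩
  indicator (b i ∧ does (i ≟ i))              ≡⟨ cong (indicator ∘ (b i ∧_)) (dec-true (i ≟ i) refl) ⟩
  indicator (b i ∧ true)                      ≡⟨ cong indicator (∧-identityʳ (b i)) ⟩
  indicator (b i)                             ∎
  where
  off-diagonal : ∀ j → j ≢ i → indicator (b j ∧ does (i ≟ j)) ≡ 0
  off-diagonal j j≢i =
    cong indicator (trans (cong (b j ∧_) (dec-false (i ≟ j) (j≢i ∘ sym))) (∧-zeroʳ (b j)))

indicator-any≡sum : ∀ {n p} {P : Pred (Fin n) p} (P? : Decidable P) →
                    (∀ i j → P i → P j → i ≡ j) →
                    indicator (does (any? P?)) ≡ sum (λ i → indicator (does (P? i)))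
indicator-any≡sum {n} P? unique with any? P?
... | yes (i , Pi) = sym (begin
  sum (λ j → indicator (does (P? j)))  ≡⟨ sum-supported-at _ i off ⟩
  indicator (does (P? i))              ≡⟨ cong indicator (dec-true (P? i) Pi) ⟩
  1                                    ∎)
  where
  off : ∀ j → j ≢ i → indicator (does (P? j)) ≡ 0
  off j j≢i = cong indicator (dec-false (P? j) (λ Pj → j≢i (unique j i Pj Pi)))
... | no ¬∃ = sym (trans (sum-cong-≗ (λ i → cong indicator (dec-false (P? i) (¬∃ ∘ (i ,_)))))
                         (trans (sum-const n 0) (*-zeroʳ n)))

sum-tabulate : ∀ {n} (f : Fin n → ℕ) → ListAction.sum (tabulate f) ≡ sum f
sum-tabulate {zero}  f = refl
sum-tabulate {suc n} f = cong (f zero +_) (sum-tabulate (f ∘ suc))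

sum-map-allFin : ∀ {n} (f : Fin n → ℕ) → ListAction.sum (map f (allFin n)) ≡ sum f
sum-map-allFin f = trans (cong ListAction.sum (map-tabulate id f)) (sum-tabulate f)

length-filter-tabulate : ∀ {n a p} {A : Set a} {P : Pred A p} (P? : Decidable P) (t : Fin n → A) →
                         length (filter P? (tabulate t)) ≡ sum (λ i → indicator (does (P? (t i))))
length-filter-tabulate {zero}  P? t = refl
length-filter-tabulate {suc n} P? t with does (P? (t zero))
... | true  = cong suc (length-filter-tabulate P? (t ∘ suc))
... | false = length-filter-tabulate P? (t ∘ suc)

length-filter-cartesianProduct : ∀ {n a b p} {A : Set a} {B : Set b} {P : Pred (A × B) p}
  (P? : Decidable P) (t : Fin n → A) (ys : List B) →
  length (filter P? (cartesianProduct (tabulate t) ys)) ≡ sum (λ i → length (filter P? (map (t i ,_) ys)))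
length-filter-cartesianProduct {zero}  P? t ys = refl
length-filter-cartesianProduct {suc n} P? t ys = begin
  length (filter P? (map (t zero ,_) ys ++ cartesianProduct (tabulate (t ∘ suc)) ys))
    ≡⟨ cong length (filter-++ P? (map (t zero ,_) ys) _) ⟩
  length (filter P? (map (t zero ,_) ys) ++ filter P? (cartesianProduct (tabulate (t ∘ suc)) ys))
    ≡⟨ length-++ (filter P? (map (t zero ,_) ys)) ⟩
  length (filter P? (map (t zero ,_) ys)) + length (filter P? (cartesianProduct (tabulate (t ∘ suc)) ys))
    ≡⟨ cong (length (filter P? (map (t zero ,_) ys)) +_) (length-filter-cartesianProduct P? (t ∘ suc) ys) ⟩
  sum (λ i → length (filter P? (map (t i ,_) ys)))
    ∎

length-filter-allFin² : ∀ {m n p} {P : Pred (Fin m × Fin n) p} (P? : Decidable P) →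
  length (filter P? (cartesianProduct (allFin m) (allFin n))) ≡
  sum (λ x → sum (λ y → indicator (does (P? (x , y)))))
length-filter-allFin² {n = n} P? = trans (length-filter-cartesianProduct P? id (allFin n))
  (sum-cong-≗ λ x → trans (cong (length ∘ filter P?) (map-tabulate id (x ,_)))
                          (length-filter-tabulate P? (x ,_)))

does-∈? : ∀ {n} (x : Fin n) (p : Subset n) → does (x ∈? p) ≡ lookup p x
does-∈? zero    (inside  ∷ p) = refl
does-∈? zero    (outside ∷ p) = refl
does-∈? (suc x) (_ ∷ p)       = does-∈? x p

∣p∣≡sum : ∀ {n} (p : Subset n) → ∣ p ∣ ≡ sum (λ x → indicator (lookup p x))
∣p∣≡sum []            = refl
∣p∣≡sum (inside  ∷ p) = cong suc (∣p∣≡sum p)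
∣p∣≡sum (outside ∷ p) = ∣p∣≡sum p

module _ {k} (H : FinGroup k) where
  open FinGroup H

  private
    group : Group _ _
    group = record { isGroup = isGroup }

  open import Algebra.Properties.Group group using (//-rightDividesˡ; //-rightDividesʳ)

  sum-∙ʳ : ∀ (f : Fin k → ℕ) h → sum (λ σ → f (σ ∙ h)) ≡ sum f
  sum-∙ʳ f h = sum-∘-inverse f (_∙ h) (_∙ h ⁻¹) (//-rightDividesˡ h) (//-rightDividesʳ h)

module _ {g m} {G : FinGroup g} (A : Action G m) where
  open FinGroup G
  open IsGroup isGroup using (inverseˡ; inverseʳ)
  open Action A

  act-inverseˡ : ∀ α x → act (α ⁻¹) (act α x) ≡ x
  act-inverseˡ α x = begin
    act (α ⁻¹) (act α x)  ≡⟨ act-comp (α ⁻¹) α x ⟨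
    act (α ⁻¹ ∙ α) x      ≡⟨ cong (λ β → act β x) (inverseˡ α) ⟩
    act ε x               ≡⟨ act-id x ⟩
    x                     ∎

  act-inverseʳ : ∀ α x → act α (act (α ⁻¹) x) ≡ x
  act-inverseʳ α x = begin
    act α (act (α ⁻¹) x)  ≡⟨ act-comp α (α ⁻¹) x ⟨
    act (α ∙ α ⁻¹) x      ≡⟨ cong (λ β → act β x) (inverseʳ α) ⟩
    act ε x               ≡⟨ act-id x ⟩
    x                     ∎

  act-injective : ∀ α {x y} → act α x ≡ act α y → x ≡ y
  act-injective α {x} {y} αx≡αy = begin
    x                     ≡⟨ act-inverseˡ α x ⟨
    act (α ⁻¹) (act α x)  ≡⟨ cong (act (α ⁻¹)) αx≡αy ⟩
    act (α ⁻¹) (act α y)  ≡⟨ act-inverseˡ α y ⟩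
    y                     ∎

  sum-act : ∀ (f : Fin m → ℕ) α → sum (λ x → f (act α x)) ≡ sum f
  sum-act f α = sum-∘-inverse f (act α) (act (α ⁻¹)) (act-inverseʳ α) (act-inverseˡ α)

module _ {g k m} (G : FinGroup g) (H : FinGroup k) (A : Action G m) (S : Fin k → Subset m) where
  open FinGroup H using (_∙_)
  open Action A

  lookup-image-act : ∀ α C x → lookup (image G H A S α C) (act α x) ≡ lookup C x
  lookup-image-act α C x = begin
    lookup (image G H A S α C) (act α x)  ≡⟨ lookup∘tabulate _ (act α x) ⟩
    does has-preimage                     ≡⟨ does-⇔ preimage has-preimage (x ∈? C) ⟩
    does (x ∈? C)                         ≡⟨ does-∈? x C ⟩
    lookup C x                            ∎
    where
    has-preimage : Dec (∃ λ y → y ∈ C × act α y ≡ act α x)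
    has-preimage = any? (λ y → (y ∈? C) ×-dec (act α y ≟ act α x))
    preimage : (∃ λ y → y ∈ C × act α y ≡ act α x) ⇔ x ∈ C
    preimage = mk⇔ (λ (y , y∈C , αy≡αx) → subst (_∈ C) (act-injective A α αy≡αx) y∈C)
                   (λ x∈C → x , x∈C , refl)

  ∣image∩∣≡sum : ∀ α C D →
                 ∣ image G H A S α C ∩ D ∣ ≡ sum (λ x → indicator (lookup C x ∧ lookup D (act α x)))
  ∣image∩∣≡sum α C D = begin
    ∣ αC ∩ D ∣                                                       ≡⟨ ∣p∣≡sum (αC ∩ D) ⟩
    sum (λ y → indicator (lookup (αC ∩ D) y))                        ≡⟨ sum-act A _ α ⟨
    sum (λ x → indicator (lookup (αC ∩ D) (act α x)))                ≡⟨ sum-cong-≗ lookup-∩ ⟩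
    sum (λ x → indicator (lookup αC (act α x) ∧ lookup D (act α x)))  ≡⟨ sum-cong-≗ lookup-αC ⟩
    sum (λ x → indicator (lookup C x ∧ lookup D (act α x)))           ∎
    where
    αC : Subset m
    αC = image G H A S α C
    lookup-∩ : ∀ x → indicator (lookup (αC ∩ D) (act α x)) ≡
                     indicator (lookup αC (act α x) ∧ lookup D (act α x))
    lookup-∩ x = cong indicator (lookup-zipWith _∧_ (act α x) αC D)
    lookup-αC : ∀ x → indicator (lookup αC (act α x) ∧ lookup D (act α x)) ≡
                      indicator (lookup C x ∧ lookup D (act α x))
    lookup-αC x = cong (λ b → indicator (b ∧ lookup D (act α x))) (lookup-image-act α C x)

  χ : Fin k → Fin m → ℕ
  χ h x = indicator (lookup (S h) x)

  incidence : Fin g → Fin k → Fin k → Fin m → ℕ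
  incidence α σ h x = χ h x * χ (σ ∙ h) (act α x)

  intersectionSum≡∑incidence : ∀ α σ → intersectionSum G H A S α σ ≡ sum (λ h → sum (incidence α σ h))
  intersectionSum≡∑incidence α σ = begin
    intersectionSum G H A S α σ
      ≡⟨ sum-map-allFin (λ h → ∣ image G H A S α (S h) ∩ S (σ ∙ h) ∣) ⟩
    sum (λ h → ∣ image G H A S α (S h) ∩ S (σ ∙ h) ∣)
      ≡⟨ sum-cong-≗ (λ h → ∣image∩∣≡sum α (S h) (S (σ ∙ h))) ⟩
    sum (λ h → sum (λ x → indicator (lookup (S h) x ∧ lookup (S (σ ∙ h)) (act α x))))
      ≡⟨ sum-cong-≗ (λ h → sum-cong-≗ (λ x → indicator-∧ (lookup (S h) x) (lookup (S (σ ∙ h)) (act α x)))) ⟩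
    sum (λ h → sum (incidence α σ h))
      ∎

  module _ (disjoint : ∀ h h′ x → x ∈ S h → x ∈ S h′ → h ≡ h′) (cover : ∀ x → ∃ λ h → x ∈ S h) where

    pairCount≡∑incidence : ∀ α σ → pairCount G H A S α σ ≡ sum (λ h → sum (incidence α σ h))
    pairCount≡∑incidence α σ = begin
      pairCount G H A S α σ
        ≡⟨ length-filter-allFin² (λ (x , y) → linked? x y ×-dec (act α x ≟ y)) ⟩
      sum (λ x → sum (λ y → indicator (does (linked? x y) ∧ does (act α x ≟ y))))
        ≡⟨ sum-cong-≗ (λ x → sum-∧-≟ (does ∘ linked? x) (act α x)) ⟩
      sum (λ x → indicator (does (linked? x (act α x))))
        ≡⟨ sum-cong-≗ (λ x → indicator-any≡sum (linked-via? x (act α x)) (unique-link x (act α x))) ⟩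
      sum (λ x → sum (λ h → indicator (does (linked-via? x (act α x) h))))
        ≡⟨ sum-cong-≗ (λ x → sum-cong-≗ (λ h → indicator-linked-via x (act α x) h)) ⟩
      sum (λ x → sum (λ h → incidence α σ h x))
        ≡⟨ ∑-comm (λ x h → incidence α σ h x) ⟩
      sum (λ h → sum (incidence α σ h))
        ∎
      where
      linked-via? : ∀ x y h → Dec (x ∈ S h × y ∈ S (σ ∙ h))
      linked-via? x y h = (x ∈? S h) ×-dec (y ∈? S (σ ∙ h))
      linked? : ∀ x y → Dec (∃ λ h → x ∈ S h × y ∈ S (σ ∙ h))
      linked? x y = any? (linked-via? x y)
      unique-link : ∀ x y h h′ → x ∈ S h × y ∈ S (σ ∙ h) → x ∈ S h′ × y ∈ S (σ ∙ h′) → h ≡ h′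
      unique-link x y h h′ (x∈Sh , _) (x∈Sh′ , _) = disjoint h h′ x x∈Sh x∈Sh′
      indicator-linked-via : ∀ x y h → indicator (does (linked-via? x y h)) ≡ χ h x * χ (σ ∙ h) y
      indicator-linked-via x y h =
        trans (cong indicator (cong₂ _∧_ (does-∈? x (S h)) (does-∈? y (S (σ ∙ h)))))
              (indicator-∧ (lookup (S h) x) (lookup (S (σ ∙ h)) y))

    sum-χ : ∀ x → sum (λ h → χ h x) ≡ 1
    sum-χ x = begin
      sum (λ h → χ h x)
        ≡⟨ sum-cong-≗ (λ h → cong indicator (does-∈? x (S h))) ⟨
      sum (λ h → indicator (does (x ∈? S h)))
        ≡⟨ indicator-any≡sum (λ h → x ∈? S h) (λ h h′ → disjoint h h′ x) ⟨
      indicator (does (any? (λ h → x ∈? S h)))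
        ≡⟨ cong indicator (dec-true (any? (λ h → x ∈? S h)) (cover x)) ⟩
      1 ∎

    sum-incidence-over-H : ∀ α h x → sum (λ σ → incidence α σ h x) ≡ χ h x
    sum-incidence-over-H α h x = begin
      sum (λ σ → χ h x * χ (σ ∙ h) (act α x))  ≡⟨ *-distribˡ-sum (χ h x) (λ σ → χ (σ ∙ h) (act α x)) ⟨
      χ h x * sum (λ σ → χ (σ ∙ h) (act α x))  ≡⟨ cong (χ h x *_) (sum-∙ʳ H (λ τ → χ τ (act α x)) h) ⟩
      χ h x * sum (λ τ → χ τ (act α x))        ≡⟨ cong (χ h x *_) (sum-χ (act α x)) ⟩
      χ h x * 1                                ≡⟨ *-identityʳ (χ h x) ⟩
      χ h x                                    ∎

    sum-intersectionSum : ∀ α → sum (intersectionSum G H A S α) ≡ m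
    sum-intersectionSum α = begin
      sum (intersectionSum G H A S α)
        ≡⟨ sum-cong-≗ (intersectionSum≡∑incidence α) ⟩
      sum (λ σ → sum (λ h → sum (incidence α σ h)))
        ≡⟨ ∑-comm (λ σ h → sum (incidence α σ h)) ⟩
      sum (λ h → sum (λ σ → sum (incidence α σ h)))
        ≡⟨ sum-cong-≗ (λ h → ∑-comm (λ σ → incidence α σ h)) ⟩
      sum (λ h → sum (λ x → sum (λ σ → incidence α σ h x)))
        ≡⟨ sum-cong-≗ (λ h → sum-cong-≗ (sum-incidence-over-H α h)) ⟩
      sum (λ h → sum (χ h))
        ≡⟨ ∑-comm χ ⟩
      sum (λ x → sum (λ h → χ h x))
        ≡⟨ sum-cong-≗ sum-χ ⟩
      sum {m} (λ _ → 1)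
        ≡⟨ sum-const m 1 ⟩
      m * 1
        ≡⟨ *-identityʳ m ⟩
      m ∎

    pairCount≡intersectionSum : ∀ α σ → pairCount G H A S α σ ≡ intersectionSum G H A S α σ
    pairCount≡intersectionSum α σ =
      trans (pairCount≡∑incidence α σ) (sym (intersectionSum≡∑incidence α σ))

    conditionII⇒conditionIII : ConditionII G H A S → ConditionIII G H A S
    conditionII⇒conditionIII ii α α≢ε σ with σ ≟ FinGroup.ε H
    ... | no σ≢ε   = ii α α≢ε σ σ≢ε
    ... | yes refl = value-from-sum (λ τ → intersectionSum G H A S α τ * k) σ m (ii α α≢ε) (begin
      sum (λ τ → intersectionSum G H A S α τ * k)  ≡⟨ *-distribʳ-sum k (intersectionSum G H A S α) ⟨
      sum (intersectionSum G H A S α) * k          ≡⟨ cong (_* k) (sum-intersectionSum α) ⟩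
      m * k                                        ≡⟨ *-comm m k ⟩
      k * m                                        ∎)

lemma2p5 : {g k m : ℕ} (G : FinGroup g) (H : FinGroup k) (A : Action G m)
           (S : Fin k → Subset m) →
           (∀ h h′ x → x ∈ S h → x ∈ S h′ → h ≡ h′) →
           (∀ x → ∃ λ h → x ∈ S h) →
           (IsRelatedDifferenceFamily G H A S ⇔ ConditionII G H A S)
           × (ConditionII G H A S ⇔ ConditionIII G H A S)
lemma2p5 {k = k} G H A S disjoint cover =
    mk⇔ (λ i α α≢ε σ σ≢ε → trans (cong (_* k) (sym (same-count α σ))) (i α α≢ε σ σ≢ε))
        (λ ii α α≢ε σ σ≢ε → trans (cong (_* k) (same-count α σ)) (ii α α≢ε σ σ≢ε))
  , mk⇔ (conditionII⇒conditionIII G H A S disjoint cover)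
        (λ iii α α≢ε σ _ → iii α α≢ε σ)
  where
  same-count : ∀ α σ → pairCount G H A S α σ ≡ intersectionSum G H A S α σ
  same-count = pairCount≡intersectionSum G H A S disjoint cover
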